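{- Let $\mathfrak F$ be a refined frame. The following are equivalent: (1) for all $x\in Z_1$, $S_\Box x\subseteq R_\Diamond x$; (2) for all $x\in Z_1$, $\mathsf d(x)\le\boxminus x$; (3) for all $x\in Z_1$, $(\boxminus x)R_\Diamond x$; (4) for all $x\in Z_1$, $\blacksquare\Gamma x\subseteq D_\Diamond\Gamma x$.
   Context: A frame is a tuple $(Z_1,Z_\partial,I,R_\Box,R_\Diamond,T)$ with $Z_1,Z_\partial$ nonempty, $I\subseteq Z_1\times Z_\partial$, $R_\Box\subseteq Z_\partial\times Z_\partial$, $R_\Diamond\subseteq Z_1\times Z_1$, $T\subseteq Z_\partial\times Z_1\times Z_\partial$. Write $x\nmid y$ iff $(x,y)\notin I$. For $U\subseteq Z_1$, $U'=\{y\in Z_\partial:\forall u\in U\ u\nmid y\}$; for $V\subseteq Z_\partial$, $V'=\{x\in Z_1:\forall v\in V\ x\nmid v\}$. $W$ is a Galois set if $W=W''$; stable sets are Galois subsets of $Z_1$, forming the complete lattice $\mathcal G(Z_1)$ (meet $=\bigcap$, join $\bigvee_i A_i=(\bigcup_iA_i)''$). On each sort $u\preceq w$ iff $\{u\}'\subseteq\{w\}'$; separated means $\preceq$ is a partial order $\le$; $\Gamma u=\{w:u\le w\}$. For a relation $R$ and tuple $\vec u$, $R\vec u=\{w:wR\vec u\}$, Galois dual $R'$: $wR'\vec u$ iff $w\in(R\vec u)'$; $R$ is smooth if every section of $R'$ is a Galois set. Let $xR'_\Box v$ iff $\forall y(yR_\Box v\Rightarrow x\nmid y)$ and $xR''_\Box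 z$ iff $\forall v(xR'_\Box v\Rightarrow z\nmid v)$. Put $\blacksquare A=(\{v\in Z_\partial:\exists y\in A'\ vR_\Box y\})'$ for $A\in\mathcal G(Z_1)$, and $D_\Diamond U=\{z\in Z_1:\exists u\in U\ zR_\Diamond u\}$ for $U\subseteq Z_1$. A refined frame satisfies: (F1) separated; (F2) each of $R_\Box,R_\Diamond,T$ is increasing in its first argument and decreasing in each other argument; (F3) for every $v\in Z_\partial,x\in Z_1$, $R_\Box v$, $R_\Diamond x$, $Txv$ are of the form $\Gamma w$; (F4) $R_\Box,R_\Diamond,T$ smooth; (F5) for each $x\in Z_1$, $S_\Box x=\{z\in Z_1:\forall p(zR''_\Box p\Rightarrow p\in\Gamma x)\}$ is of the form $\Gamma w$; (F6) for every stable $A$, $\blacksquare A\subseteq\bigvee_{x\in A}\blacksquare\Gamma x$. Point operators: for $x\in Z_1$, $\mathsf d(x)$ is the point with $R_\Diamond x=\Gamma(\mathsf d(x))$ and $\boxminus x$ the point with $S_\Box x=\Gamma(\boxminus x)$. -}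

module Defs where

open import Level using (Level; suc; _⊔_)
open import Data.Product using (Σ; ∃; _×_; _,_; proj₁; proj₂)
open import Relation.Nullary using (¬_)
open import Relation.Unary using (Pred; _⊆_; _≐_)
open import Relation.Binary.PropositionalEquality using (_≡_)
open import Function.Bundles using (_⇔_)

record Frame (a : Level) : Set (suc a) where
  field
    Z₁   : Set a
    Z∂   : Set a
    z₁   : Z₁
    z∂   : Z∂
    I    : Z₁ → Z∂ → Set a
    R□   : Z∂ → Z∂ → Set a
    R◇   : Z₁ → Z₁ → Set a
    T    : Z∂ → Z₁ → Z∂ → Set a

module FrameTheory {a : Level} (F : Frame a) where
  open Frame F public

  _∤_ : Z₁ → Z∂ → Set a
  x ∤ y = ¬ I x y

  _′₁ : Pred Z₁ a → Pred Z∂ a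
  (U ′₁) y = ∀ u → U u → u ∤ y

  _′∂ : Pred Z∂ a → Pred Z₁ a
  (V ′∂) x = ∀ v → V v → x ∤ v

  Galois₁ : Pred Z₁ a → Set a
  Galois₁ W = W ≐ ((W ′₁) ′∂)

  Galois∂ : Pred Z∂ a → Set a
  Galois∂ W = W ≐ ((W ′∂) ′₁)

  Stable : Pred Z₁ a → Set a
  Stable = Galois₁

  ⋁ : {J : Set a} → (J → Pred Z₁ a) → Pred Z₁ a
  ⋁ {J} A = (((λ z → Σ J λ j → A j z)) ′₁) ′∂

  _≼₁_ : Z₁ → Z₁ → Set a
  u ≼₁ w = ∀ y → u ∤ y → w ∤ y

  _≼∂_ : Z∂ → Z∂ → Set a
  u ≼∂ w = ∀ x → x ∤ u → x ∤ w

  -- separated: ≼ is a partial order on each sort (reflexivity and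
  -- transitivity are automatic; antisymmetry is the content)
  Separated : Set a
  Separated = (∀ u w → u ≼₁ w → w ≼₁ u → u ≡ w)
            × (∀ u w → u ≼∂ w → w ≼∂ u → u ≡ w)

  Γ₁ : Z₁ → Pred Z₁ a
  Γ₁ u w = u ≼₁ w

  Γ∂ : Z∂ → Pred Z∂ a
  Γ∂ u w = u ≼∂ w

  Monotone : Set a
  Monotone =
      (∀ u u' v → u ≼∂ u' → R□ u v → R□ u' v)
    × (∀ u v v' → v' ≼∂ v → R□ u v → R□ u v')
    × (∀ u u' v → u ≼₁ u' → R◇ u v → R◇ u' v)
    × (∀ u v v' → v' ≼₁ v → R◇ u v → R◇ u v')
    × (∀ w w' x v → w ≼∂ w' → T w x v → T w' x v)
    × (∀ w x x' v → x' ≼₁ x → T w x v → T w x' v)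
    × (∀ w x v v' → v' ≼∂ v → T w x v → T w x v')

  R□-sec : Z∂ → Pred Z∂ a
  R□-sec v w = R□ w v

  R◇-sec : Z₁ → Pred Z₁ a
  R◇-sec x w = R◇ w x

  T-sec : Z₁ → Z∂ → Pred Z∂ a
  T-sec x v w = T w x v

  PointSections : Set a
  PointSections =
      (∀ v → ∃ λ w → R□-sec v ≐ Γ∂ w)
    × (∀ x → ∃ λ w → R◇-sec x ≐ Γ₁ w)
    × (∀ x v → ∃ λ w → T-sec x v ≐ Γ∂ w)

  R□′ : Z₁ → Z∂ → Set a
  R□′ x v = (R□-sec v ′∂) x

  R◇′ : Z∂ → Z₁ → Set a
  R◇′ y x = (R◇-sec x ′₁) y

  T′ : Z₁ → Z₁ → Z∂ → Set a
  T′ w x v = (T-sec x v ′∂) w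

  Smooth : Set a
  Smooth =
      (∀ v → Galois₁ (λ x → R□′ x v))
    × (∀ x → Galois∂ (λ v → R□′ x v))
    × (∀ x → Galois∂ (λ y → R◇′ y x))
    × (∀ y → Galois₁ (λ x → R◇′ y x))
    × (∀ x v → Galois₁ (λ w → T′ w x v))
    × (∀ w v → Galois₁ (λ x → T′ w x v))
    × (∀ w x → Galois∂ (λ v → T′ w x v))

  R□″ : Z₁ → Z₁ → Set a
  R□″ x z = ∀ v → R□′ x v → z ∤ v

  S□ : Z₁ → Pred Z₁ a
  S□ x z = ∀ p → R□″ z p → Γ₁ x p

  ■ : Pred Z₁ a → Pred Z₁ a
  ■ A = (λ v → ∃ λ y → (A ′₁) y × R□ v y) ′∂

  D◇ : Pred Z₁ a → Pred Z₁ a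
  D◇ U z = ∃ λ u → U u × R◇ z u

  F5 : Set a
  F5 = ∀ x → ∃ λ w → S□ x ≐ Γ₁ w

  F6 : Set (suc a)
  F6 = ∀ (A : Pred Z₁ a) → Stable A →
         ■ A ⊆ ⋁ {J = Σ Z₁ A} (λ p → ■ (Γ₁ (proj₁ p)))

  record Refined : Set (suc a) where
    field
      separated      : Separated
      monotone       : Monotone
      pointSections  : PointSections
      smooth         : Smooth
      f5             : F5
      f6             : F6

    -- point operators: R◇ x = Γ (d x), S□ x = Γ (⊟ x)
    d : Z₁ → Z₁
    d x = proj₁ (proj₁ (proj₂ pointSections) x)

    ⊟ : Z₁ → Z₁
    ⊟ x = proj₁ (f5 x)

    Cond1 Cond2 Cond3 Cond4 : Set a
    Cond1 = ∀ x → S□ x ⊆ R◇-sec x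
    Cond2 = ∀ x → d x ≼₁ ⊟ x
    Cond3 = ∀ x → R◇ (⊟ x) x
    Cond4 = ∀ x → ■ (Γ₁ x) ⊆ D◇ (Γ₁ x)

{-# OPTIONS --safe #-}
module Submission where

-- Both S□ x and R◇-sec x are principal upsets, Γ (⊟ x) and Γ (d x), and
-- an inclusion Γ u ⊆ Γ w of principal upsets just says w ≤ u; this links
-- (1), (2) and (3). For (4), smoothness of R□ makes ■ Γ x coincide with
-- S□ x, and monotonicity of R◇ makes D◇ Γ x coincide with R◇-sec x.

open import Level using (Level)
open import Data.Product using (_×_; _,_; proj₁; proj₂)
open import Function.Bundles using (_⇔_; mk⇔; Equivalence)
open import Function.Construct.Composition using (_⇔-∘_)
open import Function.Construct.Symmetry using (⇔-sym)
open import Relation.Unary using (Pred; _⊆_; _≐_)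
open import Defs

∀-cong-⇔ : ∀ {a p q} {A : Set a} {P : A → Set p} {Q : A → Set q} →
           (∀ x → P x ⇔ Q x) → (∀ x → P x) ⇔ (∀ x → Q x)
∀-cong-⇔ P⇔Q = mk⇔ (λ P∀ x → Equivalence.to (P⇔Q x) (P∀ x))
                   (λ Q∀ x → Equivalence.from (P⇔Q x) (Q∀ x))

⊆-resp-≐ : ∀ {a ℓ} {A : Set a} {P P′ Q Q′ : Pred A ℓ} →
           P ≐ P′ → Q ≐ Q′ → (P ⊆ Q) ⇔ (P′ ⊆ Q′)
⊆-resp-≐ (P⊆P′ , P′⊆P) (Q⊆Q′ , Q′⊆Q) =
  mk⇔ (λ P⊆Q {_} x∈P′ → Q⊆Q′ (P⊆Q (P′⊆P x∈P′)))
      (λ P′⊆Q′ {_} x∈P → Q′⊆Q (P′⊆Q′ (P⊆P′ x∈P)))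

module FrameProperties {a : Level} (F : Frame a) where
  open FrameTheory F

  ≼₁-refl : ∀ u → u ≼₁ u
  ≼₁-refl u y u∤y = u∤y

  ≼₁-trans : ∀ {u v w} → u ≼₁ v → v ≼₁ w → u ≼₁ w
  ≼₁-trans u≼v v≼w y u∤y = v≼w y (u≼v y u∤y)

  Γ₁⊆Γ₁⇔≼₁ : ∀ u w → (Γ₁ u ⊆ Γ₁ w) ⇔ (w ≼₁ u)
  Γ₁⊆Γ₁⇔≼₁ u w = mk⇔ (λ Γu⊆Γw → Γu⊆Γw (≼₁-refl u))
                     (λ w≼u {_} → ≼₁-trans w≼u)

  Γ₁′₁≐∤ : ∀ x → (Γ₁ x ′₁) ≐ (x ∤_)
  Γ₁′₁≐∤ x = (λ y∈Γx′ → y∈Γx′ x (≼₁-refl x))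
           , (λ x∤y w x≼w → x≼w _ x∤y)

  ■Γ₁⊆S□ : ∀ x → ■ (Γ₁ x) ⊆ S□ x
  ■Γ₁⊆S□ x z∈■Γx p zR″p y x∤y =
    zR″p y (λ v vR□y → z∈■Γx v (y , proj₂ (Γ₁′₁≐∤ x) x∤y , vR□y))

  -- z R□′ y holds because y lies in the closure of the Galois set R□′ z.
  S□⊆■Γ₁ : (∀ z → Galois∂ (R□′ z)) → ∀ x → S□ x ⊆ ■ (Γ₁ x)
  S□⊆■Γ₁ R□′-galois x {z} z∈S□x v (y , y∈Γx′ , vR□y) =
    proj₂ (R□′-galois z) (λ p zR″p → z∈S□x p zR″p y (proj₁ (Γ₁′₁≐∤ x) y∈Γx′))
      v vR□y

  ■Γ₁≐S□ : (∀ z → Galois∂ (R□′ z)) → ∀ x → ■ (Γ₁ x) ≐ S□ x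
  ■Γ₁≐S□ R□′-galois x = ■Γ₁⊆S□ x , S□⊆■Γ₁ R□′-galois x

  D◇Γ₁≐R◇-sec : (∀ u v v′ → v′ ≼₁ v → R◇ u v → R◇ u v′) →
                ∀ x → D◇ (Γ₁ x) ≐ R◇-sec x
  D◇Γ₁≐R◇-sec R◇-antitoneʳ x =
      (λ { (u , x≼u , zR◇u) → R◇-antitoneʳ _ u x x≼u zR◇u })
    , (λ zR◇x → x , ≼₁-refl x , zR◇x)

module RefinedProperties {a : Level} {F : Frame a} (ρ : FrameTheory.Refined F) where
  open FrameTheory F
  open Refined ρ
  open FrameProperties F

  R◇-sec≐Γ₁d : ∀ x → R◇-sec x ≐ Γ₁ (d x)
  R◇-sec≐Γ₁d x = proj₂ (proj₁ (proj₂ pointSections) x)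

  S□≐Γ₁⊟ : ∀ x → S□ x ≐ Γ₁ (⊟ x)
  S□≐Γ₁⊟ x = proj₂ (f5 x)

  Cond1⇔Cond2 : Cond1 ⇔ Cond2
  Cond1⇔Cond2 = ∀-cong-⇔ λ x →
    Γ₁⊆Γ₁⇔≼₁ (⊟ x) (d x) ⇔-∘ ⊆-resp-≐ (S□≐Γ₁⊟ x) (R◇-sec≐Γ₁d x)

  Cond3⇔Cond2 : Cond3 ⇔ Cond2
  Cond3⇔Cond2 = ∀-cong-⇔ λ x →
    mk⇔ (proj₁ (R◇-sec≐Γ₁d x)) (proj₂ (R◇-sec≐Γ₁d x))

  Cond4⇔Cond1 : Cond4 ⇔ Cond1
  Cond4⇔Cond1 = ∀-cong-⇔ λ x →
    ⊆-resp-≐ (■Γ₁≐S□ (proj₁ (proj₂ smooth)) x)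
             (D◇Γ₁≐R◇-sec (proj₁ (proj₂ (proj₂ (proj₂ monotone)))) x)

lemma5p1 : ∀ {a : Level} (F : Frame a) (ρ : FrameTheory.Refined F) →
    (FrameTheory.Refined.Cond1 ρ ⇔ FrameTheory.Refined.Cond2 ρ)
    × (FrameTheory.Refined.Cond1 ρ ⇔ FrameTheory.Refined.Cond3 ρ)
    × (FrameTheory.Refined.Cond1 ρ ⇔ FrameTheory.Refined.Cond4 ρ)
lemma5p1 F ρ = Cond1⇔Cond2
             , ⇔-sym Cond3⇔Cond2 ⇔-∘ Cond1⇔Cond2
             , ⇔-sym Cond4⇔Cond1
  where open RefinedProperties ρ
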